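{- Let $H=(X,R)$ be a finite hypergraph that is $I$-type, i.e., for all $r_1,r_2\in R$ with $r_1\cap r_2\neq\emptyset$ we have $r_1\cup r_2\in R$. Then $$\chi_{um}(H)-1\;\le\;\rho(H)\;\le\;\chi_{um}(H).$$
   Context: A hypergraph $H=(X,R)$ consists of a finite ground set $X$ of points and a set $R$ of nonempty subsets of $X$ (ranges). A set $S\subseteq X$ stabs a range $r$ if $S\cap r\neq\emptyset$. Online hitting set problem on $H$: an adversary presents a finite sequence $\sigma=(r_1,\dots,r_s)$ of ranges from $R$ one at a time; a deterministic online algorithm maintains a chain of sets $C_1\subseteq C_2\subseteq\cdots$ of points of $X$, where upon arrival of $r_i$ it must ensure $C_i$ stabs $r_1,\dots,r_i$ (it may add points but never remove them). Let $\mathrm{ALG}(\sigma)$ be the final set and $\mathrm{OPT}(\sigma)$ a minimum-cardinality subset of $X$ stabbing all ranges of $\sigma$. The competitive ratio of $\mathrm{ALG}$ on $H$ is $\rho_H(\mathrm{ALG})=\max_\sigma |\mathrm{ALG}(\sigma)|/|\mathrm{OPT}(\sigma)|$ (over nonempty finite sequences), and $\rho(H)=\min_{\mathrm{ALG}}\rho_H(\mathrm{ALG})$ over all deterministic online algorithms. A coloring $c:X\to\mathbb{N}$ is a unique-max coloring of $H$ if every range $r\in R$ contains exactly one point $x$ with $c(x)=\max_{y\in r}c(y)$. $\chi_{um}(H)$ is the least $k$ such that $H$ admits a unique-max coloring using only $k$ colors. -}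

module Defs where

open import Data.Nat using (ℕ; _≤_; _*_)
open import Data.Fin as F using (Fin)
open import Data.Fin.Subset using (Subset; _∈_; _⊆_; _∩_; _∪_; ∣_∣; Nonempty)
open import Data.List using (List; []; _∷_; _∷ʳ_)
open import Data.List.Relation.Unary.All using (All)
import Data.List.Membership.Propositional as LM
open import Data.Product using (Σ; ∃; _×_)
open import Relation.Binary.PropositionalEquality using (_≡_)

-- A finite hypergraph H = (X, R) with X = Fin n and R given as a list of
-- subsets of X (duplicates are irrelevant: only membership in R is used).
-- Nonemptiness of the ranges is an explicit hypothesis of the theorem.

IType : {n : ℕ} → List (Subset n) → Set
IType R = ∀ r₁ r₂ → r₁ LM.∈ R → r₂ LM.∈ R → Nonempty (r₁ ∩ r₂) → (r₁ ∪ r₂) LM.∈ R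

Stabs : {n : ℕ} → Subset n → Subset n → Set
Stabs S r = Nonempty (S ∩ r)

StabsAll : {n : ℕ} → Subset n → List (Subset n) → Set
StabsAll S σ = All (Stabs S) σ

IsOpt : {n : ℕ} → List (Subset n) → Subset n → Set
IsOpt σ S = StabsAll S σ × (∀ T → StabsAll T σ → ∣ S ∣ ≤ ∣ T ∣)

FromR : {n : ℕ} → List (Subset n) → List (Subset n) → Set
FromR R σ = All (LM._∈ R) σ

-- A deterministic online hitting-set algorithm for (Fin n, R):
-- C σ is the set maintained after the prefix σ (in arrival order) has been
-- presented; it depends only on the ranges seen so far (online, deterministic).
record OnlineAlg (n : ℕ) (R : List (Subset n)) : Set where
  field
    C    : List (Subset n) → Subset n
    mono : ∀ σ r → FromR R σ → r LM.∈ R → C σ ⊆ C (σ ∷ʳ r)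
    stab : ∀ σ r → FromR R σ → r LM.∈ R → StabsAll (C (σ ∷ʳ r)) (σ ∷ʳ r)
open OnlineAlg public

IsUniqueMax : {n k : ℕ} → List (Subset n) → (Fin n → Fin k) → Set
IsUniqueMax {n} R c =
  ∀ r → r LM.∈ R →
    Σ (Fin n) λ x → x ∈ r ×
      (∀ y → y ∈ r → c y F.≤ c x) ×
      (∀ y → y ∈ r → c y ≡ c x → y ≡ x)

UMColorable : {n : ℕ} → List (Subset n) → ℕ → Set
UMColorable {n} R k = Σ (Fin n → Fin k) λ c → IsUniqueMax R c

IsChiUM : {n : ℕ} → List (Subset n) → ℕ → Set
IsChiUM R k = UMColorable R k × (∀ j → UMColorable R j → k ≤ j)

RhoAtMost : {n : ℕ} → List (Subset n) → ℕ → Set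
RhoAtMost R k = Σ (OnlineAlg _ R) λ A →
  ∀ r σ → FromR R (r ∷ σ) → ∀ S → IsOpt (r ∷ σ) S → ∣ C A (r ∷ σ) ∣ ≤ k * ∣ S ∣

-- t ≤ ρ(H) : every online algorithm has competitive ratio at least t, i.e.
-- (the max over σ being attained) some nonempty σ from R has |ALG(σ)| ≥ t·|OPT(σ)|.
RhoAtLeast : {n : ℕ} → List (Subset n) → ℕ → Set
RhoAtLeast R t = ∀ (A : OnlineAlg _ R) →
  Σ (List (Subset _)) λ σ → Σ (Subset _) λ r → FromR R (r ∷ σ) ×
    Σ (Subset _) λ S → IsOpt (r ∷ σ) S × t * ∣ S ∣ ≤ ∣ C A (r ∷ σ) ∣

module Submission where

-- Fix a unique-max colouring with k colours and let the algorithm stab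
-- every arriving range at its points of maximal colour.  If two such points x₁, x₂ of
-- the same colour come from ranges q₁, q₂ stabbed by a common point of OPT, then
-- q₁ ∪ q₂ is a range (I-type) whose unique maximum has the colour of both, so
-- x₁ = x₂.  Hence, colour class by colour class, sending an algorithm point to an OPT
-- point stabbing its range is injective, and |ALG| ≤ k·|OPT|.
--
-- The adversary plays inside a region U, initially the whole ground set.
-- It presents a largest range M ⊆ U; by I-type, every range inside U meeting M lies
-- in M.  Let D be the algorithm's set afterwards.  The adversary recurses into M ∖ D
-- (continuing after M) and, independently, into U ∖ M.  Ranges inside U are coloured
-- by the colouring from U ∖ M off M and, on M, by the colouring from M ∖ D with the
-- points of M ∩ D stacked on top in distinct fresh colours; every new colour is
-- matched by a point the algorithm was forced to take.  The adversary keeps the branch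
-- that forced more points.  All ranges it presents share a point, so OPT = 1 while the
-- algorithm takes at least (number of colours − 1) ≥ χ_um − 1 points.

open import Defs
open import Data.Nat using (ℕ; zero; suc; _+_; _*_; _∸_; _≤_; _<_; z≤n; s≤s)
open import Data.Nat.Properties
open import Data.Fin using (Fin; zero; suc; toℕ; fromℕ<)
open import Data.Fin.Properties using (toℕ-injective; toℕ-fromℕ<; toℕ<n; all?)
open import Data.Fin.Subset
open import Data.Fin.Subset.Properties
open import Data.Fin.Subset.Induction using (Acc; acc; ⊂-wellFounded)
open import Data.Vec using ([]; _∷_; tabulate; here; there)
open import Data.Vec.Properties using (lookup∘tabulate; []=⇒lookup; lookup⇒[]=)
open import Data.List using (List; []; _∷_; _∷ʳ_; _++_; map; allFin)
open import Data.List.Properties using (∷ʳ-++; ++-identityʳ)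
open import Data.List.Relation.Unary.Any using (here; there)
open import Data.List.Relation.Unary.All using (All)
import Data.List.Relation.Unary.All as All
open import Data.List.Relation.Unary.All.Properties using (∷ʳ⁺; ∷ʳ⁻)
open import Data.List.Membership.Propositional using () renaming (_∈_ to _∈ₗ_)
open import Data.List.Membership.Propositional.Properties using (∈-allFin; ∈-++⁺ˡ)
open import Data.Product using (Σ; ∃; _×_; _,_; proj₂)
open import Data.Sum using (_⊎_; inj₁; inj₂)
import Data.Sum as Sum
open import Data.Empty using (⊥-elim)
open import Function using (_∘_)
open import Level using (Level)
open import Relation.Nullary using (¬_; yes; no; does; contradiction)
open import Relation.Nullary.Decidable using (dec-true; _×-dec_; _→-dec_)
open import Relation.Unary using (Pred; Decidable)
open import Relation.Binary.PropositionalEquality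
  using (_≡_; _≢_; refl; sym; trans; cong; subst; subst₂)

private variable
  ℓ : Level
  n : ℕ
  x : Fin n
  p q r : Subset n
  A : Set

⟦_⟧ : {P : Pred (Fin n) ℓ} → Decidable P → Subset n
⟦ P? ⟧ = tabulate (does ∘ P?)

module _ {P : Pred (Fin n) ℓ} (P? : Decidable P) where

  ∈⟦⟧⁺ : P x → x ∈ ⟦ P? ⟧
  ∈⟦⟧⁺ {x} px = lookup⇒[]= x ⟦ P? ⟧ (trans (lookup∘tabulate _ x) (dec-true (P? x) px))

  ∈⟦⟧⁻ : x ∈ ⟦ P? ⟧ → P x
  ∈⟦⟧⁻ {x} x∈ with P? x | trans (sym (lookup∘tabulate (does ∘ P?) x)) ([]=⇒lookup x∈)
  ... | yes px | _ = px

x∈p─q⇒x∉q : x ∈ p ─ q → x ∉ q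
x∈p─q⇒x∉q {p = _ ∷ p} {q = outside ∷ q} (there x∈) (there x∈q) = x∈p─q⇒x∉q {p = p} x∈ x∈q
x∈p─q⇒x∉q {p = _ ∷ p} {q = inside ∷ q} (there x∈) (there x∈q) = x∈p─q⇒x∉q {p = p} x∈ x∈q

∣p∣≡∣p∩q∣+∣p─q∣ : ∀ (p q : Subset n) → ∣ p ∣ ≡ ∣ p ∩ q ∣ + ∣ p ─ q ∣
∣p∣≡∣p∩q∣+∣p─q∣ []            []            = refl
∣p∣≡∣p∩q∣+∣p─q∣ (inside  ∷ p) (inside  ∷ q) = cong suc (∣p∣≡∣p∩q∣+∣p─q∣ p q)
∣p∣≡∣p∩q∣+∣p─q∣ (inside  ∷ p) (outside ∷ q) =
  trans (cong suc (∣p∣≡∣p∩q∣+∣p─q∣ p q)) (sym (+-suc _ _))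
∣p∣≡∣p∩q∣+∣p─q∣ (outside ∷ p) (inside  ∷ q) = ∣p∣≡∣p∩q∣+∣p─q∣ p q
∣p∣≡∣p∩q∣+∣p─q∣ (outside ∷ p) (outside ∷ q) = ∣p∣≡∣p∩q∣+∣p─q∣ p q

Empty⇒∣p∣≡0 : Empty p → ∣ p ∣ ≡ 0
Empty⇒∣p∣≡0 {n} e = trans (cong ∣_∣ (Empty-unique e)) (∣⊥∣≡0 n)

∣p∣≤1+∣p-x∣ : ∀ (p : Subset n) x → ∣ p ∣ ≤ suc ∣ p - x ∣
∣p∣≤1+∣p-x∣ p x = begin
  ∣ p ∣                       ≡⟨ ∣p∣≡∣p∩q∣+∣p─q∣ p ⁅ x ⁆ ⟩
  ∣ p ∩ ⁅ x ⁆ ∣ + ∣ p - x ∣   ≤⟨ +-monoˡ-≤ _ (∣p∩q∣≤∣q∣ p ⁅ x ⁆) ⟩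
  ∣ ⁅ x ⁆ ∣ + ∣ p - x ∣       ≡⟨ cong (_+ ∣ p - x ∣) (∣⁅x⁆∣≡1 x) ⟩
  suc ∣ p - x ∣               ∎
  where open ≤-Reasoning

disjoint⇒∣p∣+∣q∣≤∣r∣ : p ⊆ r → q ⊆ r → (∀ {x} → x ∈ p → x ∉ q) → ∣ p ∣ + ∣ q ∣ ≤ ∣ r ∣
disjoint⇒∣p∣+∣q∣≤∣r∣ {p = p} {r = r} {q = q} p⊆r q⊆r p∩q≡∅ = begin
  ∣ p ∣ + ∣ q ∣             ≤⟨ +-mono-≤ (p⊆q⇒∣p∣≤∣q∣ p⊆r∩p) (p⊆q⇒∣p∣≤∣q∣ q⊆r─p) ⟩
  ∣ r ∩ p ∣ + ∣ r ─ p ∣     ≡⟨ sym (∣p∣≡∣p∩q∣+∣p─q∣ r p) ⟩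
  ∣ r ∣                     ∎
  where
  open ≤-Reasoning
  p⊆r∩p : p ⊆ r ∩ p
  p⊆r∩p x∈p = x∈p∩q⁺ (p⊆r x∈p , x∈p)
  q⊆r─p : q ⊆ r ─ p
  q⊆r─p x∈q = x∈p∧x∉q⇒x∈p─q (q⊆r x∈q) (λ x∈p → p∩q≡∅ x∈p x∈q)

module _ (_∼_ : Fin n → Fin n → Set) where

  PartnersIn : Subset n → Subset n → Set
  PartnersIn p q = ∀ {x} → x ∈ p → ∃ λ y → y ∈ q × x ∼ y

  DistinctPartners : Subset n → Set
  DistinctPartners p = ∀ {x x′ y} → x ∈ p → x′ ∈ p → x ∼ y → x′ ∼ y → x ≡ x′

  matching⇒∣p∣≤∣q∣ : PartnersIn p q → DistinctPartners p → ∣ p ∣ ≤ ∣ q ∣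
  matching⇒∣p∣≤∣q∣ {p = p} = go (⊂-wellFounded p)
    where
    go : ∀ {p q} → Acc _⊂_ p → PartnersIn p q → DistinctPartners p → ∣ p ∣ ≤ ∣ q ∣
    go {p} {q} (acc rec) partners distinct with nonempty? p
    ... | no  p≡∅ = ≤-trans (≤-reflexive (Empty⇒∣p∣≡0 p≡∅)) z≤n
    ... | yes (a , a∈p) with partners a∈p
    ...   | b , b∈q , a∼b = begin
      ∣ p ∣          ≤⟨ ∣p∣≤1+∣p-x∣ p a ⟩
      suc ∣ p - a ∣  ≤⟨ s≤s (go (rec (x∈p⇒p-x⊂p a∈p)) partners′ distinct′) ⟩
      suc ∣ q - b ∣  ≤⟨ x∈p⇒∣p-x∣<∣p∣ b∈q ⟩
      ∣ q ∣          ∎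
      where
      open ≤-Reasoning
      distinct′ : DistinctPartners (p - a)
      distinct′ x∈ x′∈ = distinct (p─q⊆p p _ x∈) (p─q⊆p p _ x′∈)
      partners′ : PartnersIn (p - a) (q - b)
      partners′ x∈ with partners (p─q⊆p p _ x∈)
      ... | y , y∈q , x∼y = y , x∈p∧x≢y⇒x∈p-y y∈q y≢b , x∼y
        where
        y≢b : y ≢ b
        y≢b refl = x∉⁅y⁆⇒x≢y (x∈p─q⇒x∉q {p = p} x∈) (distinct (p─q⊆p p _ x∈) a∈p x∼y a∼b)

  matching⇒∣p∣≤k*∣q∣ : (c : Fin n → ℕ) (k : ℕ) → (∀ {x} → x ∈ p → c x < k) → PartnersIn p q →
    (∀ {x x′ y} → x ∈ p → x′ ∈ p → c x ≡ c x′ → x ∼ y → x′ ∼ y → x ≡ x′) →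
    ∣ p ∣ ≤ k * ∣ q ∣
  matching⇒∣p∣≤k*∣q∣ c zero    c<0 _ _ = ≤-reflexive (Empty⇒∣p∣≡0 λ (_ , x∈p) → n≮0 (c<0 x∈p))
  matching⇒∣p∣≤k*∣q∣ {p = p} {q} c (suc k) c<1+k partners distinct = begin
    ∣ p ∣                     ≡⟨ ∣p∣≡∣p∩q∣+∣p─q∣ p top ⟩
    ∣ p ∩ top ∣ + ∣ p ─ top ∣ ≤⟨ +-mono-≤ (matching⇒∣p∣≤∣q∣ (partners ∘ p∩q⊆p p top) distinct-top)
                                 (matching⇒∣p∣≤k*∣q∣ c k c<k (partners ∘ p─q⊆p p top) distinct-rest) ⟩
    ∣ q ∣ + k * ∣ q ∣         ∎
    where
    open ≤-Reasoning
    colour≟k : Decidable (λ x → c x ≡ k)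
    colour≟k x = c x ≟ k
    top : Subset _
    top = ⟦ colour≟k ⟧
    distinct-top : DistinctPartners (p ∩ top)
    distinct-top x∈ x′∈ = distinct (p∩q⊆p p top x∈) (p∩q⊆p p top x′∈)
      (trans (∈⟦⟧⁻ colour≟k (p∩q⊆q p top x∈)) (sym (∈⟦⟧⁻ colour≟k (p∩q⊆q p top x′∈))))
    distinct-rest : ∀ {x x′ y} → x ∈ p ─ top → x′ ∈ p ─ top → c x ≡ c x′ → x ∼ y → x′ ∼ y → x ≡ x′
    distinct-rest x∈ x′∈ = distinct (p─q⊆p p top x∈) (p─q⊆p p top x′∈)
    c<k : ∀ {x} → x ∈ p ─ top → c x < k
    c<k x∈ = ≤∧≢⇒< (≤-pred (c<1+k (p─q⊆p p top x∈))) (x∈p─q⇒x∉q {p = p} x∈ ∘ ∈⟦⟧⁺ colour≟k)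

rank : Subset n → Fin n → ℕ
rank (_       ∷ p) zero    = 0
rank (inside  ∷ p) (suc x) = suc (rank p x)
rank (outside ∷ p) (suc x) = rank p x

rank<∣p∣ : ∀ {p : Subset n} {x} → x ∈ p → rank p x < ∣ p ∣
rank<∣p∣ {p = inside  ∷ p} here       = s≤s z≤n
rank<∣p∣ {p = inside  ∷ p} (there x∈) = s≤s (rank<∣p∣ x∈)
rank<∣p∣ {p = outside ∷ p} (there x∈) = rank<∣p∣ x∈

rank-injective : ∀ {p : Subset n} {x y} → x ∈ p → y ∈ p → rank p x ≡ rank p y → x ≡ y
rank-injective here here _ = refl
rank-injective {p = inside  ∷ p} (there x∈) (there y∈) eq =
  cong suc (rank-injective x∈ y∈ (suc-injective eq))
rank-injective {p = outside ∷ p} (there x∈) (there y∈) eq = cong suc (rank-injective x∈ y∈ eq)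

module _ {P : Pred A ℓ} (P? : Decidable P) (f : A → ℕ) where

  maximiser : ∀ xs → (∀ {x} → x ∈ₗ xs → ¬ P x) ⊎
    ∃ λ m → m ∈ₗ xs × P m × (∀ {x} → x ∈ₗ xs → P x → f x ≤ f m)
  maximiser [] = inj₁ λ ()
  maximiser (x ∷ xs) with maximiser xs | P? x
  ... | inj₁ none | no ¬px = inj₁ λ { (here refl) → ¬px ; (there x∈) → none x∈ }
  ... | inj₁ none | yes px = inj₂ (x , here refl , px , λ
          { (here refl) _ → ≤-refl ; (there y∈) py → contradiction py (none y∈) })
  ... | inj₂ (m , m∈ , pm , max) | no ¬px = inj₂ (m , there m∈ , pm , λ
          { (here refl) px → contradiction px ¬px ; (there y∈) → max y∈ })
  ... | inj₂ (m , m∈ , pm , max) | yes px with f x ≤? f m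
  ...   | yes fx≤fm = inj₂ (m , there m∈ , pm , λ { (here refl) _ → fx≤fm ; (there y∈) → max y∈ })
  ...   | no fx≰fm  = inj₂ (x , here refl , px , λ
          { (here refl) _ → ≤-refl ; (there y∈) py → ≤-trans (max y∈ py) (<⇒≤ (≰⇒> fx≰fm)) })

maximum : (f : Fin n → ℕ) → Nonempty p → ∃ λ x → x ∈ p × (∀ {y} → y ∈ p → f y ≤ f x)
maximum {p = p} f (x , x∈p) with maximiser (_∈? p) f (allFin _)
... | inj₁ none = contradiction x∈p (none (∈-allFin x))
... | inj₂ (m , _ , m∈p , max) = m , m∈p , max (∈-allFin _)

∈-nonempty : ∀ {xs : List A} → xs ≢ [] → ∃ (_∈ₗ xs)
∈-nonempty {xs = []}    xs≢[] = contradiction refl xs≢[]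
∈-nonempty {xs = x ∷ _} _     = x , here refl

UniqueMaxOn : (Fin n → ℕ) → Subset n → Set
UniqueMaxOn {n} c q = Σ (Fin n) λ x → x ∈ q ×
  (∀ y → y ∈ q → c y ≤ c x) × (∀ y → y ∈ q → c y ≡ c x → y ≡ x)

UniqueMaxOn-cong : ∀ {c c′ : Fin n → ℕ} {q} →
  (∀ {y} → y ∈ q → c y ≡ c′ y) → UniqueMaxOn c′ q → UniqueMaxOn c q
UniqueMaxOn-cong {c = c} {c′} c≗c′ (x , x∈q , max , unique) =
  x , x∈q , max′ , λ y y∈q cy≡cx → unique y y∈q (trans (sym (c≗c′ y∈q)) (trans cy≡cx (c≗c′ x∈q)))
  where
  max′ : ∀ y → y ∈ _ → c y ≤ c x
  max′ y y∈q = subst₂ _≤_ (sym (c≗c′ y∈q)) (sym (c≗c′ x∈q)) (max y y∈q)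

dominant⇒UniqueMaxOn : ∀ {c : Fin n → ℕ} {S q} → Nonempty (q ∩ S) →
  (∀ {x y} → x ∈ S → y ∈ S → c x ≡ c y → x ≡ y) →
  (∀ {x y} → x ∈ S → y ∈ q → y ∉ S → c y < c x) →
  UniqueMaxOn c q
dominant⇒UniqueMaxOn {c = c} {S} {q} q∩S≢∅ injective dominant
  with maximum c q∩S≢∅
... | m , m∈q∩S , max-on-S = m , p∩q⊆p q S m∈q∩S , max , unique
  where
  m∈S = p∩q⊆q q S m∈q∩S
  max : ∀ y → y ∈ q → c y ≤ c m
  max y y∈q with y ∈? S
  ... | yes y∈S = max-on-S (x∈p∩q⁺ (y∈q , y∈S))
  ... | no  y∉S = <⇒≤ (dominant m∈S y∈q y∉S)
  unique : ∀ y → y ∈ q → c y ≡ c m → y ≡ m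
  unique y y∈q cy≡cm with y ∈? S
  ... | yes y∈S = injective y∈S m∈S cy≡cm
  ... | no  y∉S = contradiction cy≡cm (<⇒≢ (dominant m∈S y∈q y∉S))

piecewise : Subset n → (Fin n → A) → (Fin n → A) → Fin n → A
piecewise p f g x with x ∈? p
... | yes _ = f x
... | no  _ = g x

module _ {p : Subset n} {f g : Fin n → A} where

  piecewise-∈ : x ∈ p → piecewise p f g x ≡ f x
  piecewise-∈ {x} x∈p with x ∈? p
  ... | yes _   = refl
  ... | no  x∉p = contradiction x∈p x∉p

  piecewise-∉ : x ∉ p → piecewise p f g x ≡ g x
  piecewise-∉ {x} x∉p with x ∈? p
  ... | yes x∈p = contradiction x∈p x∉p
  ... | no  _   = refl

-- The points of S receive the distinct fresh colours h + 1, …, h + ∣ S ∣.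
stack : Subset n → ℕ → (Fin n → ℕ) → Fin n → ℕ
stack S h c = piecewise S (λ x → suc (h + rank S x)) c

module _ {S : Subset n} {h} {c : Fin n → ℕ} (c≤h : ∀ x → c x ≤ h) where

  stack≤ : ∀ x → stack S h c x ≤ h + ∣ S ∣
  stack≤ x with x ∈? S
  ... | yes x∈S = subst (_≤ h + ∣ S ∣) (+-suc h _) (+-monoʳ-≤ h (rank<∣p∣ x∈S))
  ... | no  _   = ≤-trans (c≤h x) (m≤m+n h _)

  stack-UniqueMaxOn : ∀ {q} → Nonempty (q ∩ S) → UniqueMaxOn (stack S h c) q
  stack-UniqueMaxOn q∩S≢∅ = dominant⇒UniqueMaxOn q∩S≢∅ injective dominant
    where
    injective : ∀ {x y} → x ∈ S → y ∈ S → stack S h c x ≡ stack S h c y → x ≡ y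
    injective x∈S y∈S eq = rank-injective x∈S y∈S (+-cancelˡ-≡ h _ _ (suc-injective
      (trans (sym (piecewise-∈ x∈S)) (trans eq (piecewise-∈ y∈S)))))
    dominant : ∀ {x y} → x ∈ S → y ∈ _ → y ∉ S → stack S h c y < stack S h c x
    dominant x∈S _ y∉S = subst₂ _<_ (sym (piecewise-∉ y∉S)) (sym (piecewise-∈ x∈S))
      (s≤s (≤-trans (c≤h _) (m≤m+n h _)))

-- Fin's _≤_ is _≤_ on toℕ, so the maximality parts transfer unchanged.
module _ {n} {R : List (Subset n)} where

  IsUniqueMax⇒UniqueMaxOn : ∀ {k} {c : Fin n → Fin k} → IsUniqueMax R c →
    ∀ {q} → q ∈ₗ R → UniqueMaxOn (toℕ ∘ c) q
  IsUniqueMax⇒UniqueMaxOn isUniqueMax q∈R with isUniqueMax _ q∈R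
  ... | x , x∈q , max , unique = x , x∈q , max , λ y y∈q eq → unique y y∈q (toℕ-injective eq)

  UniqueMaxOn⇒UMColorable : ∀ {h} (c : Fin n → ℕ) → (∀ x → c x ≤ h) →
    (∀ {q} → q ∈ₗ R → UniqueMaxOn c q) → UMColorable R (suc h)
  UniqueMaxOn⇒UMColorable {h} c c≤h uniqueMax = c′ , isUniqueMax
    where
    c′ : Fin n → Fin (suc h)
    c′ x = fromℕ< (s≤s (c≤h x))
    isUniqueMax : IsUniqueMax R c′
    isUniqueMax q q∈R with UniqueMaxOn-cong (λ {y} _ → toℕ-fromℕ< (s≤s (c≤h y))) (uniqueMax q∈R)
    ... | x , x∈q , max , unique = x , x∈q , max , λ y y∈q eq → unique y y∈q (cong toℕ eq)

-- Upper bound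

module PeakAlgorithm {n} {R : List (Subset n)} (iType : IType R)
  (c : Fin n → ℕ) (uniqueMax : ∀ {q} → q ∈ₗ R → UniqueMaxOn c q) where

  IsPeak : Subset n → Fin n → Set
  IsPeak q x = x ∈ q × (∀ y → y ∈ q → c y ≤ c x)

  isPeak? : ∀ q → Decidable (IsPeak q)
  isPeak? q x = x ∈? q ×-dec all? (λ y → y ∈? q →-dec c y ≤? c x)

  peak : Subset n → Subset n
  peak q = ⟦ isPeak? q ⟧

  ∈peak⁺ : ∀ {q x} → IsPeak q x → x ∈ peak q
  ∈peak⁺ {q} = ∈⟦⟧⁺ (isPeak? q)

  ∈peak⁻ : ∀ {q x} → x ∈ peak q → IsPeak q x
  ∈peak⁻ {q} = ∈⟦⟧⁻ (isPeak? q)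

  -- The unique maximum z of the range q₁ ∪ q₂ has the colour of both peaks.
  peak-colour-injective : ∀ {q₁ q₂ x₁ x₂} → q₁ ∈ₗ R → q₂ ∈ₗ R → Nonempty (q₁ ∩ q₂) →
    IsPeak q₁ x₁ → IsPeak q₂ x₂ → c x₁ ≡ c x₂ → x₁ ≡ x₂
  peak-colour-injective {q₁} {q₂} {x₁} {x₂} q₁∈R q₂∈R meet (x₁∈q₁ , max₁) (x₂∈q₂ , max₂) c₁≡c₂
    with uniqueMax (iType q₁ q₂ q₁∈R q₂∈R meet)
  ... | z , z∈q , maxz , unique = trans (is-z x₁∈q c₁≡cz) (sym (is-z x₂∈q (trans (sym c₁≡c₂) c₁≡cz)))
    where
    x₁∈q = x∈p∪q⁺ {p = q₁} {q = q₂} (inj₁ x₁∈q₁)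
    x₂∈q = x∈p∪q⁺ {p = q₁} {q = q₂} (inj₂ x₂∈q₂)
    is-z : ∀ {y} → y ∈ q₁ ∪ q₂ → c y ≡ c z → y ≡ z
    is-z = unique _
    cz≤c₁ : c z ≤ c x₁
    cz≤c₁ with x∈p∪q⁻ q₁ q₂ z∈q
    ... | inj₁ z∈q₁ = max₁ z z∈q₁
    ... | inj₂ z∈q₂ = subst (c z ≤_) (sym c₁≡c₂) (max₂ z z∈q₂)
    c₁≡cz : c x₁ ≡ c z
    c₁≡cz = ≤-antisym (maxz x₁ x₁∈q) cz≤c₁

  peaks : List (Subset n) → Subset n
  peaks σ = ⋃ (map peak σ)

  ∈peaks⁺ : ∀ {σ q x} → q ∈ₗ σ → x ∈ peak q → x ∈ peaks σ
  ∈peaks⁺ {q′ ∷ σ} (here refl) x∈ = x∈p∪q⁺ (inj₁ x∈)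
  ∈peaks⁺ {q′ ∷ σ} (there q∈) x∈ = x∈p∪q⁺ {p = peak q′} (inj₂ (∈peaks⁺ q∈ x∈))

  ∈peaks⁻ : ∀ {σ x} → x ∈ peaks σ → ∃ λ q → q ∈ₗ σ × x ∈ peak q
  ∈peaks⁻ {[]}    x∈ = contradiction x∈ ∉⊥
  ∈peaks⁻ {q ∷ σ} x∈ with x∈p∪q⁻ (peak q) (peaks σ) x∈
  ... | inj₁ x∈peak = q , here refl , x∈peak
  ... | inj₂ x∈rest with ∈peaks⁻ x∈rest
  ...   | q′ , q′∈σ , x∈peak = q′ , there q′∈σ , x∈peak

  peaks-stab : ∀ {σ} → FromR R σ → StabsAll (peaks σ) σ
  peaks-stab σ∈R = All.tabulate λ q∈σ → peak-point (All.lookup σ∈R q∈σ) q∈σ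
    where
    peak-point : ∀ {q σ} → q ∈ₗ R → q ∈ₗ σ → Stabs (peaks σ) q
    peak-point q∈R q∈σ with uniqueMax q∈R
    ... | x , x∈q , max , _ = x , x∈p∩q⁺ (∈peaks⁺ q∈σ (∈peak⁺ (x∈q , max)) , x∈q)

  algorithm : OnlineAlg n R
  algorithm = record
    { C    = peaks
    ; mono = λ σ r _ _ x∈ →
        let q , q∈σ , x∈peak = ∈peaks⁻ {σ} x∈ in ∈peaks⁺ {σ ∷ʳ r} (∈-++⁺ˡ q∈σ) x∈peak
    ; stab = λ σ r σ∈R r∈R → peaks-stab (∷ʳ⁺ σ∈R r∈R)
    }

  peaks-competitive : ∀ {k σ S} → (∀ x → c x < k) → FromR R σ → StabsAll S σ →
    ∣ peaks σ ∣ ≤ k * ∣ S ∣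
  peaks-competitive {k} {σ} {S} c<k σ∈R S-stabs =
    matching⇒∣p∣≤k*∣q∣ _∼_ c k (λ {x} _ → c<k x) match injective
    where
    _∼_ : Fin n → Fin n → Set
    x ∼ s = ∃ λ q → q ∈ₗ R × IsPeak q x × s ∈ q
    match : PartnersIn _∼_ (peaks σ) S
    match x∈ with ∈peaks⁻ x∈
    ... | q , q∈σ , x∈peak with All.lookup S-stabs q∈σ
    ...   | s , s∈S∩q =
      s , p∩q⊆p S q s∈S∩q , q , All.lookup σ∈R q∈σ , ∈peak⁻ x∈peak , p∩q⊆q S q s∈S∩q
    injective : ∀ {x x′ s} → x ∈ peaks σ → x′ ∈ peaks σ → c x ≡ c x′ → x ∼ s → x′ ∼ s → x ≡ x′
    injective _ _ cx≡cx′ (q , q∈R , x-peak , s∈q) (q′ , q′∈R , x′-peak , s∈q′) =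
      peak-colour-injective q∈R q′∈R (_ , x∈p∩q⁺ (s∈q , s∈q′)) x-peak x′-peak cx≡cx′

rhoAtMost : ∀ {n} {R : List (Subset n)} {k} → IType R → UMColorable R k → RhoAtMost R k
rhoAtMost iType (c , isUniqueMax) =
  algorithm , λ r σ rσ∈R S (S-stabs , _) → peaks-competitive (toℕ<n ∘ c) rσ∈R S-stabs
  where open PeakAlgorithm iType (toℕ ∘ c) (IsUniqueMax⇒UniqueMaxOn isUniqueMax)

-- Lower bound

PiercedIn : Subset n → List (Subset n) → Set
PiercedIn {n} U τ = ∃ λ (p : Fin n) → p ∈ U × All (p ∈_) τ

PiercedIn-mono : ∀ {U V : Subset n} {τ} → U ⊆ V → PiercedIn U τ → PiercedIn V τ
PiercedIn-mono U⊆V (p , p∈U , p∈τ) = p , U⊆V p∈U , p∈τ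

PiercedIn-∷ : ∀ {U M : Subset n} {τ} → Nonempty M → U ⊆ M →
  τ ≡ [] ⊎ PiercedIn U τ → PiercedIn M (M ∷ τ)
PiercedIn-∷ (p , p∈M) _ (inj₁ refl) = p , p∈M , p∈M All.∷ All.[]
PiercedIn-∷ _ U⊆M (inj₂ (p , p∈U , p∈τ)) = p , U⊆M p∈U , U⊆M p∈U All.∷ p∈τ

singleton-IsOpt : ∀ {p : Fin n} {r σ} → All (p ∈_) (r ∷ σ) → IsOpt (r ∷ σ) ⁅ p ⁆
singleton-IsOpt {p = p} p∈rσ = All.map (λ p∈q → p , x∈p∩q⁺ (x∈⁅x⁆ p , p∈q)) p∈rσ , optimal
  where
  optimal : ∀ T → StabsAll T _ → ∣ ⁅ p ⁆ ∣ ≤ ∣ T ∣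
  optimal T ((x , x∈T∩r) All.∷ _) = subst (_≤ ∣ T ∣) (sym (∣⁅x⁆∣≡1 p))
    (≤-trans (s≤s z≤n) (x∈p⇒∣p-x∣<∣p∣ (p∩q⊆p T _ x∈T∩r)))

module Adversary {n} {R : List (Subset n)} (nonempty : All Nonempty R) (iType : IType R)
  (A : OnlineAlg n R) where

  UniqueMaxInside : Subset n → (Fin n → ℕ) → Set
  UniqueMaxInside U c = ∀ {q} → q ∈ₗ R → q ⊆ U → UniqueMaxOn c q

  IsLargestIn : Subset n → Subset n → Set
  IsLargestIn U M = M ∈ₗ R × M ⊆ U × (∀ {q} → q ∈ₗ R → q ⊆ U → ∣ q ∣ ≤ ∣ M ∣)

  -- Otherwise M ∪ q would be a larger range inside U, by I-type.
  IsLargestIn-absorbs : ∀ {U M q} → IsLargestIn U M → q ∈ₗ R → q ⊆ U → Nonempty (M ∩ q) → q ⊆ M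
  IsLargestIn-absorbs {U} {M} {q} (M∈R , M⊆U , largest) q∈R q⊆U meet {x} x∈q with x ∈? M
  ... | yes x∈M = x∈M
  ... | no  x∉M = contradiction (largest (iType M q M∈R q∈R meet) M∪q⊆U) (<⇒≱ ∣M∣<∣M∪q∣)
    where
    M∪q⊆U : M ∪ q ⊆ U
    M∪q⊆U y∈ = Sum.[ M⊆U , q⊆U ] (x∈p∪q⁻ M q y∈)
    ∣M∣<∣M∪q∣ : ∣ M ∣ < ∣ M ∪ q ∣
    ∣M∣<∣M∪q∣ = p⊂q⇒∣p∣<∣q∣ (p⊆p∪q q , x , x∈p∪q⁺ (inj₂ x∈q) , x∉M)

  stack-UniqueMaxInside : ∀ {U M D h′} {c′ c″ : Fin n → ℕ} → IsLargestIn U M →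
    (∀ x → c′ x ≤ h′) → UniqueMaxInside (M ─ D) c′ → UniqueMaxInside (U ─ M) c″ →
    UniqueMaxInside U (piecewise M (stack (M ∩ D) h′ c′) c″)
  stack-UniqueMaxInside {U} {M} {D} largest c′≤h′ inner outer {q} q∈R q⊆U
    with nonempty? (M ∩ q)
  ... | no  M∩q≡∅ = UniqueMaxOn-cong (λ y∈q → piecewise-∉ (y∉M y∈q)) (outer q∈R q⊆U─M)
    where
    y∉M : ∀ {y} → y ∈ q → y ∉ M
    y∉M y∈q y∈M = M∩q≡∅ (_ , x∈p∩q⁺ (y∈M , y∈q))
    q⊆U─M : q ⊆ U ─ M
    q⊆U─M y∈q = x∈p∧x∉q⇒x∈p─q (q⊆U y∈q) (y∉M y∈q)
  ... | yes meet with IsLargestIn-absorbs largest q∈R q⊆U meet | nonempty? (q ∩ (M ∩ D))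
  ...   | q⊆M | yes q∩S≢∅ =
    UniqueMaxOn-cong (piecewise-∈ ∘ q⊆M) (stack-UniqueMaxOn c′≤h′ q∩S≢∅)
  ...   | q⊆M | no  q∩S≡∅ =
    UniqueMaxOn-cong (λ y∈q → trans (piecewise-∈ (q⊆M y∈q)) (piecewise-∉ (y∉S y∈q))) (inner q∈R q⊆M─D)
    where
    y∉S : ∀ {y} → y ∈ q → y ∉ M ∩ D
    y∉S y∈q y∈S = q∩S≡∅ (_ , x∈p∩q⁺ (y∈q , y∈S))
    q⊆M─D : q ⊆ M ─ D
    q⊆M─D y∈q = x∈p∧x∉q⇒x∈p─q (q⊆M y∈q) (λ y∈D → y∉S y∈q (x∈p∩q⁺ (q⊆M y∈q , y∈D)))

  -- The adversary, playing inside U after σ, continues with τ; each of the colours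
  -- 1, …, height is paid for by a point the algorithm takes beyond W.
  record Outcome (σ : List (Subset n)) (U W : Subset n) : Set where
    field
      height        : ℕ
      colour        : Fin n → ℕ
      colour≤height : ∀ x → colour x ≤ height
      uniqueMax     : UniqueMaxInside U colour
      τ             : List (Subset n)
      τ∈R           : FromR R τ
      pierced       : τ ≡ [] ⊎ PiercedIn U τ
      cost          : ∣ W ∣ + height ≤ ∣ C A (σ ++ τ) ∣

  nothing-inside : ∀ {σ U W} → W ⊆ C A σ → (∀ {q} → q ∈ₗ R → q ⊈ U) → Outcome σ U W
  nothing-inside {σ} {W = W} W⊆Cσ none = record
    { height = 0 ; colour = λ _ → 0 ; colour≤height = λ _ → z≤n
    ; uniqueMax = λ q∈R q⊆U → ⊥-elim (none q∈R q⊆U)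
    ; τ = [] ; τ∈R = All.[] ; pierced = inj₁ refl
    ; cost = subst₂ _≤_ (sym (+-identityʳ ∣ W ∣)) (cong (∣_∣ ∘ C A) (sym (++-identityʳ σ)))
               (p⊆q⇒∣p∣≤∣q∣ W⊆Cσ)
    }

  stacked : ∀ {σ U W M} → FromR R σ → W ⊆ C A σ → (∀ {x} → x ∈ U → x ∉ W) → IsLargestIn U M →
    Outcome (σ ∷ʳ M) (M ─ C A (σ ∷ʳ M)) (C A (σ ∷ʳ M)) → Outcome σ (U ─ M) W → Outcome σ U W
  stacked {σ} {U} {W} {M} σ∈R W⊆Cσ U∩W≡∅ largest@(M∈R , M⊆U , _) inner outer =
    Sum.[ viaM , viaOuter ]′ (≤-total O.height hM)
    where
    module I = Outcome inner
    module O = Outcome outer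
    D = C A (σ ∷ʳ M)
    hM = I.height + ∣ M ∩ D ∣

    colour : Fin n → ℕ
    colour = piecewise M (stack (M ∩ D) I.height I.colour) O.colour

    colour≤ : ∀ {h} → hM ≤ h → O.height ≤ h → ∀ x → colour x ≤ h
    colour≤ hM≤h hO≤h x with x ∈? M
    ... | yes _ = ≤-trans (stack≤ I.colour≤height x) hM≤h
    ... | no  _ = ≤-trans (O.colour≤height x) hO≤h

    uniqueMax : UniqueMaxInside U colour
    uniqueMax = stack-UniqueMaxInside largest I.colour≤height I.uniqueMax O.uniqueMax

    cost : ∣ W ∣ + hM ≤ ∣ C A (σ ++ M ∷ I.τ) ∣
    cost = begin
      ∣ W ∣ + (I.height + ∣ M ∩ D ∣)  ≡⟨ cong (∣ W ∣ +_) (+-comm I.height _) ⟩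
      ∣ W ∣ + (∣ M ∩ D ∣ + I.height)  ≡⟨ sym (+-assoc ∣ W ∣ _ I.height) ⟩
      ∣ W ∣ + ∣ M ∩ D ∣ + I.height    ≤⟨ +-monoˡ-≤ I.height W+M∩D≤D ⟩
      ∣ D ∣ + I.height                ≤⟨ I.cost ⟩
      ∣ C A (σ ∷ʳ M ++ I.τ) ∣         ≡⟨ cong (∣_∣ ∘ C A) (∷ʳ-++ σ M I.τ) ⟩
      ∣ C A (σ ++ M ∷ I.τ) ∣          ∎
      where
      open ≤-Reasoning
      W+M∩D≤D : ∣ W ∣ + ∣ M ∩ D ∣ ≤ ∣ D ∣
      W+M∩D≤D = disjoint⇒∣p∣+∣q∣≤∣r∣ (mono A σ M σ∈R M∈R ∘ W⊆Cσ) (p∩q⊆q M D)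
        (λ x∈W x∈M∩D → U∩W≡∅ (M⊆U (p∩q⊆p M D x∈M∩D)) x∈W)

    viaM : O.height ≤ hM → Outcome σ U W
    viaM hO≤hM = record
      { height = hM ; colour = colour ; colour≤height = colour≤ ≤-refl hO≤hM ; uniqueMax = uniqueMax
      ; τ = M ∷ I.τ ; τ∈R = M∈R All.∷ I.τ∈R
      ; pierced = inj₂ (PiercedIn-mono M⊆U
          (PiercedIn-∷ (All.lookup nonempty M∈R) (p─q⊆p M D) I.pierced))
      ; cost = cost
      }

    viaOuter : hM ≤ O.height → Outcome σ U W
    viaOuter hM≤hO = record
      { height = O.height ; colour = colour ; colour≤height = colour≤ hM≤hO ≤-refl
      ; uniqueMax = uniqueMax ; τ = O.τ ; τ∈R = O.τ∈R
      ; pierced = Sum.map₂ (PiercedIn-mono (p─q⊆p U M)) O.pierced ; cost = O.cost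
      }

  adversary : ∀ U → Acc _⊂_ U → ∀ {σ W} → FromR R σ → W ⊆ C A σ → (∀ {x} → x ∈ U → x ∉ W) →
    Outcome σ U W
  adversary U (acc rec) {σ} {W} σ∈R W⊆Cσ U∩W≡∅ with maximiser (_⊆? U) ∣_∣ R
  ... | inj₁ none = nothing-inside W⊆Cσ none
  ... | inj₂ (M , M∈R , M⊆U , largest) = stacked σ∈R W⊆Cσ U∩W≡∅ (M∈R , M⊆U , largest)
    (adversary (M ─ D) (rec (⊂-⊆-trans (p∩q≢∅⇒p─q⊂p M D M∩D≢∅) M⊆U))
      (∷ʳ⁺ σ∈R M∈R) (λ x∈D → x∈D) (x∈p─q⇒x∉q {p = M}))
    (adversary (U ─ M) (rec (p∩q≢∅⇒p─q⊂p U M U∩M≢∅)) σ∈R W⊆Cσ (U∩W≡∅ ∘ p─q⊆p U M))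
    where
    D = C A (σ ∷ʳ M)
    M∩D≢∅ : Nonempty (M ∩ D)
    M∩D≢∅ with proj₂ (∷ʳ⁻ (stab A σ M σ∈R M∈R))
    ... | x , x∈D∩M = x , x∈p∩q⁺ (p∩q⊆q D M x∈D∩M , p∩q⊆p D M x∈D∩M)
    U∩M≢∅ : Nonempty (U ∩ M)
    U∩M≢∅ with All.lookup nonempty M∈R
    ... | x , x∈M = x , x∈p∩q⁺ (M⊆U x∈M , x∈M)

  -- Since the algorithm's set only grows, an empty sequence can be replaced by any
  -- single range.
  nonempty-run : R ≢ [] → ∀ {h} τ → FromR R τ → τ ≡ [] ⊎ PiercedIn ⊤ τ → h ≤ ∣ C A τ ∣ →
    ∃ λ r → ∃ λ σ → FromR R (r ∷ σ) × PiercedIn ⊤ (r ∷ σ) × h ≤ ∣ C A (r ∷ σ) ∣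
  nonempty-run _     (r ∷ σ) rσ∈R (inj₂ pierced) h≤ = r , σ , rσ∈R , pierced , h≤
  nonempty-run _     (_ ∷ _) _    (inj₁ ())
  nonempty-run R≢[] []       _    _             h≤ =
    let r , r∈R = ∈-nonempty R≢[] ; p , p∈r = All.lookup nonempty r∈R in
    r , [] , r∈R All.∷ All.[] , (p , ∈⊤ , p∈r All.∷ All.[]) ,
    ≤-trans h≤ (p⊆q⇒∣p∣≤∣q∣ (mono A [] r All.[] r∈R))

  forcing : R ≢ [] → ∃ λ r → ∃ λ σ → FromR R (r ∷ σ) × PiercedIn ⊤ (r ∷ σ) ×
    ∃ λ h → UMColorable R (suc h) × h ≤ ∣ C A (r ∷ σ) ∣
  forcing R≢[] =
    let r , σ , rσ∈R , pierced , h≤ = nonempty-run R≢[] O.τ O.τ∈R O.pierced height≤ in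
    r , σ , rσ∈R , pierced , O.height , colourable , h≤
    where
    module O = Outcome (adversary ⊤ (⊂-wellFounded ⊤) All.[] ⊥⊆ (λ _ → ∉⊥))
    height≤ = subst (_≤ ∣ C A O.τ ∣) (cong (_+ O.height) (∣⊥∣≡0 n)) O.cost
    colourable = UniqueMaxOn⇒UMColorable O.colour O.colour≤height (λ q∈R → O.uniqueMax q∈R ⊆⊤)

pierced⇒RhoAtLeast : ∀ {n} {R : List (Subset n)} {t} →
  (∀ A → ∃ λ r → ∃ λ σ → FromR R (r ∷ σ) × PiercedIn ⊤ (r ∷ σ) × t ≤ ∣ C A (r ∷ σ) ∣) →
  RhoAtLeast R t
pierced⇒RhoAtLeast {t = t} forcing A with forcing A
... | r , σ , rσ∈R , (p , _ , p∈rσ) , t≤ = σ , r , rσ∈R , ⁅ p ⁆ , singleton-IsOpt p∈rσ ,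
  subst (_≤ _) (sym (trans (cong (t *_) (∣⁅x⁆∣≡1 p)) (*-identityʳ t))) t≤

theorem1 : (n : ℕ) (R : List (Subset n)) → All Nonempty R → R ≢ [] →
    IType R → (k : ℕ) → IsChiUM R k →
    RhoAtLeast R (k ∸ 1) × RhoAtMost R k
theorem1 n R nonempty R≢[] iType k (colourable , minimal) =
  pierced⇒RhoAtLeast forces , rhoAtMost iType colourable
  where
  forces : ∀ A → ∃ λ r → ∃ λ σ → FromR R (r ∷ σ) × PiercedIn ⊤ (r ∷ σ) × k ∸ 1 ≤ ∣ C A (r ∷ σ) ∣
  forces A with Adversary.forcing nonempty iType A R≢[]
  ... | r , σ , rσ∈R , pierced , h , colourable′ , h≤ =
    r , σ , rσ∈R , pierced , ≤-trans (∸-monoˡ-≤ 1 (minimal (suc h) colourable′)) h≤
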